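{- Let $a(n)$ denote the number of attainable partitions of $n$ for $n\geq 1$, and set $a(0)=1$. Then, as formal power series in $q$, \[ \sum_{n=0}^{\infty} a(n)q^n = \frac{1}{1-q}\prod_{i=1}^{\infty}\frac{1}{1-q^{i(i+1)}}. \]
   Context: A partition of a positive integer $n$ is a tuple $\lambda=(n_1,n_2,\dots,n_r)$ of positive integers with $n_1\geq n_2\geq\dots\geq n_r$ and $n_1+\dots+n_r=n$; $r$ is its length. The cyclicity index of $\lambda$ is $c(\lambda)=\sum_{i=1}^r(3-2i)n_i$. The partition $\lambda$ is called attainable if $c(\lambda)\geq 0$. -}

module Defs where

open import Data.Nat as ℕ using (ℕ; zero; suc; _+_; _*_; _∸_; _≥_; _>_)
open import Data.Nat.Divisibility using (_∣?_)
open import Data.Integer as ℤ using (ℤ; +_)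
open import Data.List using (List; []; _∷_; map; upTo)
open import Data.Nat.ListAction using (sum)
open import Data.List.Relation.Unary.All using (All)
open import Data.List.Relation.Unary.Linked using (Linked)
open import Data.Bool using (if_then_else_)
open import Relation.Nullary using (does)
open import Relation.Binary.PropositionalEquality using (_≡_)
open import Data.Product using (_×_)

IsPartition : ℕ → List ℕ → Set
IsPartition n λs = All (λ x → x > 0) λs × Linked _≥_ λs × sum λs ≡ n

cycAux : ℤ → List ℕ → ℤ
cycAux w []       = + 0
cycAux w (x ∷ xs) = w ℤ.* (+ x) ℤ.+ cycAux (w ℤ.- + 2) xs

-- cyclicity index c(λ) = Σ_{i=1}^r (3 - 2i) n_i ; the weight for i = 1 is 1.
cyc : List ℕ → ℤ
cyc = cycAux (+ 1)

Attainable : List ℕ → Set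
Attainable λs = + 0 ℤ.≤ cyc λs

Series : Set
Series = ℕ → ℕ

_⊛_ : Series → Series → Series
(f ⊛ g) n = sum (map (λ k → f k * g (n ∸ k)) (upTo (suc n)))

oneS : Series
oneS zero    = 1
oneS (suc _) = 0

-- 1/(1 - q^k) = Σ_m q^{k m}
geom : ℕ → Series
geom k n = if does (k ∣? n) then 1 else 0

prodUpTo : ℕ → Series
prodUpTo zero    = oneS
prodUpTo (suc N) = prodUpTo N ⊛ geom (suc N * suc (suc N))

-- ∏_{i=1}^{∞} 1/(1 - q^{i(i+1)}) : the coefficient of q^n stabilises once
-- i(i+1) > n for all further factors, in particular from N = n on.
prodInf : Series
prodInf n = prodUpTo n n

rhs : Series
rhs = geom 1 ⊛ prodInf

-- For λ = (n₁, …, n_r) one has c(λ) = n₁ − Σ_{i≥2} (2i−3) nᵢ, so λ is attainable with c(λ) = s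
-- exactly when n₁ = s + Σ_{i≥2} (2i−3) nᵢ, and then n = s + Σ_{i≥2} (2i−2) nᵢ.  Writing the
-- tail as suffix sums, n_{j+1} = e_j + e_{j+1} + ⋯ with eₖ ≥ 0, turns this into
-- n = s + Σₖ k(k+1) eₖ.  So attainable partitions of n correspond bijectively to pairs (s, e)
-- with s + Σₖ k(k+1) eₖ = n, which is what 1/(1−q) ∏ₖ 1/(1−q^{k(k+1)}) counts.

module Submission where

open import Defs
open import Data.Nat using (ℕ; zero; suc; _+_; _*_; _∸_; _≤_; _≥_; _>_; NonZero; s≤s; s≤s⁻¹; z≤n)
open import Data.Nat.Properties
open import Data.Nat.Divisibility using (_∣?_; divides)
open import Data.Nat.ListAction using (sum)
open import Data.Nat.Tactic.RingSolver using (solve-∀)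
open import Data.Integer as ℤ using (ℤ; ∣_∣)
import Data.Integer.Properties as ℤ
import Data.Integer.Tactic.RingSolver as ℤ-Solver
open import Data.List
  using (List; length; []; _∷_; [_]; _++_; _∷ʳ_; map; concatMap; cartesianProduct; upTo; replicate
        ; filter; drop; initLast; _∷ʳ′_)
open import Data.List.Properties
  using (length-map; length-++; length-replicate; map-cong; ∷ʳ-injective)
open import Data.List.Membership.Propositional using (_∈_; find; lose)
open import Data.List.Membership.Propositional.Properties
  using (∈-map⁺; ∈-map⁻; ∈-concatMap⁺; ∈-concatMap⁻; ∈-cartesianProduct⁺; ∈-cartesianProduct⁻
        ; ∈-upTo⁺; ∈-upTo⁻)
open import Data.List.Relation.Unary.Any using (here; there)
open import Data.List.Relation.Unary.All as All using (All; []; _∷_)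
import Data.List.Relation.Unary.All.Properties as All
import Data.List.Relation.Unary.AllPairs.Properties as AllPairs
open import Data.List.Relation.Unary.AllPairs as AllPairs using ([]; _∷_)
open import Data.List.Relation.Unary.Linked using (Linked; []; [-]; _∷_; tail)
import Data.List.Relation.Unary.Linked.Properties as Linked
open import Data.List.Relation.Unary.Unique.Propositional using (Unique)
import Data.List.Relation.Unary.Unique.Propositional.Properties as Unique
open import Data.Product using (_×_; _,_; ∃; ∃₂; uncurry; proj₁; proj₂)
open import Function using (_∘_)
open import Function.Bundles using (_⇔_; mk⇔; Equivalence)
import Function.Properties.Equivalence as ⇔
open import Relation.Nullary using (yes; no; contradiction)
open import Relation.Binary.PropositionalEquality
  using (_≡_; refl; sym; trans; cong; cong₂; subst; module ≡-Reasoning)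

private
  variable
    A B : Set

record IsListing (P : A → Set) (xs : List A) : Set where
  field
    membership : ∀ x → x ∈ xs ⇔ P x
    unique   : Unique xs

open IsListing

listing-cong : {P Q : A → Set} {xs : List A} → (∀ x → P x ⇔ Q x) → IsListing P xs → IsListing Q xs
listing-cong P⇔Q L = record { membership = λ x → ⇔.trans (membership L x) (P⇔Q x) ; unique = unique L }

unique-map⁺-local : {f : A → B} {xs : List A} → (∀ {x y} → x ∈ xs → y ∈ xs → f x ≡ f y → x ≡ y) →
                    Unique xs → Unique (map f xs)
unique-map⁺-local {xs = []}     _   []          = []
unique-map⁺-local {xs = x ∷ xs} inj (x∉xs ∷ xs!) =
  All.map⁺ (All.tabulate λ y∈xs fx≡fy → All.lookup x∉xs y∈xs (inj (here refl) (there y∈xs) fx≡fy))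
  ∷ unique-map⁺-local (λ x∈ y∈ → inj (there x∈) (there y∈)) xs!

unique-concatMap⁺ : (f : A → List B) {xs : List A} → Unique xs → (∀ x → Unique (f x)) →
                    (∀ {x x′ y} → y ∈ f x → y ∈ f x′ → x ≡ x′) → Unique (concatMap f xs)
unique-concatMap⁺ f xs! f! disjoint =
  Unique.concat⁺ (All.map⁺ (All.universal f! _))
                 (AllPairs.map⁺ {f = f} (AllPairs.map (λ x≢x′ {_} (p , q) → x≢x′ (disjoint p q)) xs!))

length-concatMap : (f : A → List B) (xs : List A) → length (concatMap f xs) ≡ sum (map (length ∘ f) xs)
length-concatMap f []       = refl
length-concatMap f (x ∷ xs) = trans (length-++ (f x)) (cong (length (f x) +_) (length-concatMap f xs))

length-cartesianProduct : (xs : List A) (ys : List B) →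
                          length (cartesianProduct xs ys) ≡ length xs * length ys
length-cartesianProduct []       ys = refl
length-cartesianProduct (x ∷ xs) ys = trans (length-++ (map (x ,_) ys))
  (cong₂ _+_ (length-map (x ,_) ys) (length-cartesianProduct xs ys))

length-∷ʳ : (xs : List A) (x : A) → length (xs ∷ʳ x) ≡ suc (length xs)
length-∷ʳ xs x = trans (length-++ xs) (+-comm (length xs) 1)

map-listing : {P : A → Set} {Q : B → Set} (f : A → B) {xs : List A} → IsListing P xs →
              (∀ a → P a → Q (f a)) → (∀ b → Q b → ∃ λ a → P a × f a ≡ b) →
              (∀ a a′ → P a → P a′ → f a ≡ f a′ → a ≡ a′) →
              IsListing Q (map f xs)
map-listing {P = P} {Q} f {xs} L into onto inj = record
  { membership = λ b → mk⇔ (listed⇒Q b) (Q⇒listed b)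
  ; unique   = unique-map⁺-local (λ a∈ a′∈ → inj _ _ (listed⇒P a∈) (listed⇒P a′∈)) (unique L)
  }
  where
  listed⇒P : ∀ {a} → a ∈ xs → P a
  listed⇒P {a} = Equivalence.to (membership L a)
  listed⇒Q : ∀ b → b ∈ map f xs → Q b
  listed⇒Q b b∈ with _ , a∈ , refl ← ∈-map⁻ f b∈ = into _ (listed⇒P a∈)
  Q⇒listed : ∀ b → Q b → b ∈ map f xs
  Q⇒listed b Qb with a , Pa , refl ← onto b Qb = ∈-map⁺ f (Equivalence.from (membership L a) Pa)

convolve : (ℕ → List A) → (ℕ → List B) → ℕ → List (A × B)
convolve F G n = concatMap (λ k → cartesianProduct (F k) (G (n ∸ k))) (upTo (suc n))

Convolution : (ℕ → A → Set) → (ℕ → B → Set) → ℕ → A × B → Set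
Convolution P Q n (a , b) = ∃₂ λ k l → k + l ≡ n × P k a × Q l b

length-convolve : {F : ℕ → List A} {G : ℕ → List B} {f g : Series} →
                  (∀ k → length (F k) ≡ f k) → (∀ l → length (G l) ≡ g l) →
                  ∀ n → length (convolve F G n) ≡ (f ⊛ g) n
length-convolve {F = F} {G} |F|≡f |G|≡g n =
  trans (length-concatMap (λ k → cartesianProduct (F k) (G (n ∸ k))) (upTo (suc n)))
  (cong sum (map-cong (λ k → trans (length-cartesianProduct (F k) (G (n ∸ k)))
                                   (cong₂ _*_ (|F|≡f k) (|G|≡g (n ∸ k))))
                      (upTo (suc n))))

convolve-listing : {P : ℕ → A → Set} {Q : ℕ → B → Set} {F : ℕ → List A} {G : ℕ → List B} →
                   (∀ k → IsListing (P k) (F k)) → (∀ l → IsListing (Q l) (G l)) →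
                   (∀ k k′ a → P k a → P k′ a → k ≡ k′) →
                   ∀ n → IsListing (Convolution P Q n) (convolve F G n)
convolve-listing {A = A} {B = B} {P = P} {Q} {F} {G} LF LG disjoint n = record
  { membership = λ ab → mk⇔ listed⇒convolution convolution⇒listed
  ; unique   = unique-concatMap⁺ layer (Unique.upTo⁺ (suc n))
                 (λ k → Unique.cartesianProduct⁺ (unique (LF k)) (unique (LG (n ∸ k))))
                 layer-disjoint
  }
  where
  layer : ℕ → List (A × B)
  layer k = cartesianProduct (F k) (G (n ∸ k))
  layer-disjoint : ∀ {k k′ ab} → ab ∈ layer k → ab ∈ layer k′ → k ≡ k′
  layer-disjoint {k} {k′} p q = disjoint k k′ _
    (Equivalence.to (membership (LF k) _) (proj₁ (∈-cartesianProduct⁻ (F k) (G (n ∸ k)) p)))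
    (Equivalence.to (membership (LF k′) _) (proj₁ (∈-cartesianProduct⁻ (F k′) (G (n ∸ k′)) q)))
  listed⇒convolution : ∀ {ab} → ab ∈ convolve F G n → Convolution P Q n ab
  listed⇒convolution ab∈ with k , k∈ , ab∈layer ← find (∈-concatMap⁻ layer ab∈) =
    let a∈ , b∈ = ∈-cartesianProduct⁻ (F k) (G (n ∸ k)) ab∈layer in
    k , n ∸ k , m+[n∸m]≡n (s≤s⁻¹ (∈-upTo⁻ k∈)) ,
    Equivalence.to (membership (LF k) _) a∈ , Equivalence.to (membership (LG (n ∸ k)) _) b∈
  convolution⇒listed : ∀ {ab} → Convolution P Q n ab → ab ∈ convolve F G n
  convolution⇒listed {a , b} (k , l , refl , Pa , Qb) = ∈-concatMap⁺ layer (lose k∈ ab∈layer)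
    where
    k∈ : k ∈ upTo (suc (k + l))
    k∈ = ∈-upTo⁺ (s≤s (m≤m+n k l))
    ab∈layer : (a , b) ∈ layer k
    ab∈layer = ∈-cartesianProduct⁺ (Equivalence.from (membership (LF k) a) Pa)
                 (subst (λ l′ → b ∈ G l′) (sym (m+n∸m≡n k l)) (Equivalence.from (membership (LG l) b) Qb))

exactQuotients : ℕ → ℕ → List ℕ
exactQuotients w r with w ∣? r
... | yes (divides q _) = [ q ]
... | no _              = []

length-exactQuotients : ∀ w r → length (exactQuotients w r) ≡ geom w r
length-exactQuotients w r with w ∣? r
... | yes _ = refl
... | no _  = refl

exactQuotients-listing : ∀ w .{{_ : NonZero w}} r → IsListing (λ e → w * e ≡ r) (exactQuotients w r)
exactQuotients-listing w r with w ∣? r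
... | yes (divides q r≡qw) = record
  { membership = λ e → mk⇔ (λ { (here refl) → sym (trans r≡qw (*-comm q w)) })
                         (λ we≡r → here (*-cancelˡ-≡ e q w (trans we≡r (trans r≡qw (*-comm q w)))))
  ; unique   = [] ∷ []
  }
... | no w∤r = record
  { membership = λ e → mk⇔ (λ ()) (λ we≡r → contradiction (divides e (trans (sym we≡r) (*-comm w e))) w∤r)
  ; unique   = []
  }

pronic : ℕ → ℕ
pronic n = n * suc n

pronicWeightedSum : ℕ → List ℕ → ℕ
pronicWeightedSum o []       = 0
pronicWeightedSum o (e ∷ es) = pronic (suc o) * e + pronicWeightedSum (suc o) es

pronicWeightedSum-∷ʳ : ∀ o u e →
  pronicWeightedSum o (u ∷ʳ e) ≡ pronicWeightedSum o u + pronic (suc (o + length u)) * e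
pronicWeightedSum-∷ʳ o [] e rewrite +-identityʳ o = +-identityʳ _
pronicWeightedSum-∷ʳ o (x ∷ u) e rewrite pronicWeightedSum-∷ʳ (suc o) u e | +-suc o (length u) =
  sym (+-assoc (pronic (suc o) * x) (pronicWeightedSum (suc o) u) _)

Weighted : ℕ → ℕ → List ℕ → Set
Weighted N m c = length c ≡ N × pronicWeightedSum 0 c ≡ m

weightedLists : ℕ → ℕ → List (List ℕ)
weightedLists zero    zero    = [ [] ]
weightedLists zero    (suc m) = []
weightedLists (suc N) m       =
  map (uncurry _∷ʳ_) (convolve (weightedLists N) (exactQuotients (pronic (suc N))) m)

length-weightedLists : ∀ N m → length (weightedLists N m) ≡ prodUpTo N m
length-weightedLists zero    zero    = refl
length-weightedLists zero    (suc m) = refl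
length-weightedLists (suc N) m       =
  trans (length-map (uncurry _∷ʳ_) (convolve (weightedLists N) (exactQuotients (pronic (suc N))) m))
  (length-convolve {F = weightedLists N} {G = exactQuotients (pronic (suc N))}
     (length-weightedLists N) (length-exactQuotients (pronic (suc N))) m)

weightedLists-listing : ∀ N m → IsListing (Weighted N m) (weightedLists N m)
weightedLists-listing zero zero = record { membership = membership-[] ; unique = [] ∷ [] }
  where
  membership-[] : ∀ c → c ∈ [ [] ] ⇔ Weighted 0 0 c
  membership-[] []      = mk⇔ (λ _ → refl , refl) (λ _ → here refl)
  membership-[] (_ ∷ _) = mk⇔ (λ { (here ()) ; (there ()) }) (λ ())
weightedLists-listing zero (suc m) = record { membership = membership-none ; unique = [] }
  where
  membership-none : ∀ c → c ∈ [] ⇔ Weighted 0 (suc m) c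
  membership-none []      = mk⇔ (λ ()) (λ ())
  membership-none (_ ∷ _) = mk⇔ (λ ()) (λ ())
weightedLists-listing (suc N) m =
  map-listing (uncurry _∷ʳ_)
    (convolve-listing (weightedLists-listing N) (exactQuotients-listing (pronic (suc N))) same-weight m)
    snoc-weighted unsnoc-weighted snoc-injective
  where
  same-weight : ∀ k k′ u → Weighted N k u → Weighted N k′ u → k ≡ k′
  same-weight _ _ _ (_ , w≡k) (_ , w≡k′) = trans (sym w≡k) w≡k′
  Split : List ℕ × ℕ → Set
  Split = Convolution (Weighted N) (λ l e → pronic (suc N) * e ≡ l) m
  snoc-weighted : ∀ ue → Split ue → Weighted (suc N) m (uncurry _∷ʳ_ ue)
  snoc-weighted (u , e) (k , l , k+l≡m , (refl , refl) , refl) =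
    length-∷ʳ u e , trans (pronicWeightedSum-∷ʳ 0 u e) k+l≡m
  unsnoc-weighted : ∀ v → Weighted (suc N) m v → ∃ λ ue → Split ue × uncurry _∷ʳ_ ue ≡ v
  unsnoc-weighted v (|v|≡1+N , w≡m) with initLast v
  ... | []      = contradiction |v|≡1+N λ ()
  ... | u ∷ʳ′ e =
    (u , e) , (pronicWeightedSum 0 u , pronic (suc N) * e , weight≡m , (|u|≡N , refl) , refl) , refl
    where
    |u|≡N : length u ≡ N
    |u|≡N = suc-injective (trans (sym (length-∷ʳ u e)) |v|≡1+N)
    weight≡m : pronicWeightedSum 0 u + pronic (suc N) * e ≡ m
    weight≡m = trans (cong (λ L → pronicWeightedSum 0 u + pronic (suc L) * e) (sym |u|≡N))
                     (trans (sym (pronicWeightedSum-∷ʳ 0 u e)) w≡m)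
  snoc-injective : ∀ ue ue′ → Split ue → Split ue′ → uncurry _∷ʳ_ ue ≡ uncurry _∷ʳ_ ue′ → ue ≡ ue′
  snoc-injective (u , e) (u′ , e′) _ _ eq with refl , refl ← ∷ʳ-injective u u′ eq = refl

suffixSums : List ℕ → List ℕ
suffixSums []       = []
suffixSums (e ∷ es) = e + sum es ∷ suffixSums es

differences : List ℕ → List ℕ
differences []          = []
differences (x ∷ [])    = [ x ]
differences (x ∷ y ∷ r) = x ∸ y ∷ differences (y ∷ r)

length-suffixSums : ∀ c → length (suffixSums c) ≡ length c
length-suffixSums []       = refl
length-suffixSums (e ∷ es) = cong suc (length-suffixSums es)

length-differences : ∀ t → length (differences t) ≡ length t
length-differences []          = refl
length-differences (x ∷ [])    = refl
length-differences (x ∷ y ∷ r) = cong suc (length-differences (y ∷ r))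

suffixSums-decreasing : ∀ c → Linked _≥_ (suffixSums c)
suffixSums-decreasing []            = []
suffixSums-decreasing (e ∷ [])      = [-]
suffixSums-decreasing (e ∷ e′ ∷ es) = m≤n+m (e′ + sum es) e ∷ suffixSums-decreasing (e′ ∷ es)

differences-suffixSums : ∀ c → differences (suffixSums c) ≡ c
differences-suffixSums []            = refl
differences-suffixSums (e ∷ [])      = cong [_] (+-identityʳ e)
differences-suffixSums (e ∷ e′ ∷ es) =
  cong₂ _∷_ (m+n∸n≡m e (e′ + sum es)) (differences-suffixSums (e′ ∷ es))

sum-differences : ∀ {x t} → Linked _≥_ (x ∷ t) → sum (differences (x ∷ t)) ≡ x
sum-differences {x} {[]}    _         = +-identityʳ x
sum-differences {x} {y ∷ t} (y≤x ∷ ↓) = trans (cong (x ∸ y +_) (sum-differences ↓)) (m∸n+n≡m y≤x)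

suffixSums-differences : ∀ {t} → Linked _≥_ t → suffixSums (differences t) ≡ t
suffixSums-differences {[]}        _         = refl
suffixSums-differences {x ∷ []}    _         = cong [_] (+-identityʳ x)
suffixSums-differences {x ∷ y ∷ t} (y≤x ∷ ↓) =
  cong₂ _∷_ (trans (cong (x ∸ y +_) (sum-differences ↓)) (m∸n+n≡m y≤x)) (suffixSums-differences ↓)

oddWeightedSum : ℕ → List ℕ → ℕ
oddWeightedSum o []       = 0
oddWeightedSum o (x ∷ xs) = suc (2 * o) * x + oddWeightedSum (suc o) xs

-- Since Σ_{i≤j} (2i + 2) = (j + 1)(j + 2), the weights 2i + 2 on suffix sums become pronic weights.
oddWeightedSum-suffixSums : ∀ o c →
  oddWeightedSum o (suffixSums c) + sum (suffixSums c) + pronic o * sum c ≡ pronicWeightedSum o c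
oddWeightedSum-suffixSums o []       = *-zeroʳ (pronic o)
oddWeightedSum-suffixSums o (e ∷ es) = begin
  suc (2 * o) * (e + S) + X + (e + S + Y) + pronic o * (e + S)
    ≡⟨ regroup o e S X Y ⟩
  pronic (suc o) * e + (X + Y + pronic (suc o) * S)
    ≡⟨ cong (pronic (suc o) * e +_) (oddWeightedSum-suffixSums (suc o) es) ⟩
  pronic (suc o) * e + pronicWeightedSum (suc o) es ∎
  where
  open ≡-Reasoning
  S X Y : ℕ
  S = sum es
  X = oddWeightedSum (suc o) (suffixSums es)
  Y = sum (suffixSums es)
  regroup : ∀ o e S X Y → suc (2 * o) * (e + S) + X + (e + S + Y) + o * suc o * (e + S)
                        ≡ suc o * suc (suc o) * e + (X + Y + suc o * suc (suc o) * S)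
  regroup = solve-∀

pronicWeightedSum-suffixSums : ∀ c →
  oddWeightedSum 0 (suffixSums c) + sum (suffixSums c) ≡ pronicWeightedSum 0 c
pronicWeightedSum-suffixSums c = trans (sym (+-identityʳ _)) (oddWeightedSum-suffixSums 0 c)

padTo : ℕ → List ℕ → List ℕ
padTo k p = p ++ replicate (k ∸ length p) 0

length-padTo : ∀ {k} p → length p ≤ k → length (padTo k p) ≡ k
length-padTo p |p|≤k =
  trans (length-++ p) (trans (cong (length p +_) (length-replicate _)) (m+[n∸m]≡n |p|≤k))

dropZeros : List ℕ → List ℕ
dropZeros = filter (_>? 0)

dropZeros-replicate : ∀ k → dropZeros (replicate k 0) ≡ []
dropZeros-replicate zero    = refl
dropZeros-replicate (suc k) = dropZeros-replicate k

dropZeros-++-zeros : ∀ {xs} k → All (_> 0) xs → dropZeros (xs ++ replicate k 0) ≡ xs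
dropZeros-++-zeros k []                        = dropZeros-replicate k
dropZeros-++-zeros k (_∷_ {x = suc x} _ xs>0) = cong (suc x ∷_) (dropZeros-++-zeros k xs>0)

decreasing-from-0 : ∀ {t} → Linked _≥_ (0 ∷ t) → t ≡ replicate (length t) 0
decreasing-from-0 {[]}    _          = refl
decreasing-from-0 {_ ∷ _} (z≤n ∷ ↓) = cong (0 ∷_) (decreasing-from-0 ↓)

padTo-dropZeros : ∀ {q} → Linked _≥_ q → padTo (length q) (dropZeros q) ≡ q
padTo-dropZeros {[]}        _   = refl
padTo-dropZeros {zero ∷ t}  ↓   = begin
  padTo (suc (length t)) (dropZeros t)
    ≡⟨ cong (padTo (suc (length t)) ∘ dropZeros) t≡0s ⟩
  padTo (suc (length t)) (dropZeros (replicate (length t) 0))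
    ≡⟨ cong (padTo (suc (length t))) (dropZeros-replicate (length t)) ⟩
  0 ∷ replicate (length t) 0
    ≡⟨ cong (0 ∷_) t≡0s ⟨
  0 ∷ t ∎
  where
  open ≡-Reasoning
  t≡0s : t ≡ replicate (length t) 0
  t≡0s = decreasing-from-0 ↓
padTo-dropZeros {suc x ∷ t} ↓   = cong (suc x ∷_) (padTo-dropZeros (tail ↓))

sum-++-zeros : ∀ xs k → sum (xs ++ replicate k 0) ≡ sum xs
sum-++-zeros []       zero    = refl
sum-++-zeros []       (suc k) = sum-++-zeros [] k
sum-++-zeros (x ∷ xs) k       = cong (x +_) (sum-++-zeros xs k)

oddWeightedSum-++-zeros : ∀ o xs k → oddWeightedSum o (xs ++ replicate k 0) ≡ oddWeightedSum o xs
oddWeightedSum-++-zeros o []       zero    = refl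
oddWeightedSum-++-zeros o []       (suc k) =
  cong₂ _+_ (*-zeroʳ (suc (2 * o))) (oddWeightedSum-++-zeros (suc o) [] k)
oddWeightedSum-++-zeros o (x ∷ xs) k       =
  cong (suc (2 * o) * x +_) (oddWeightedSum-++-zeros (suc o) xs k)

cycAux-++-zeros : ∀ w xs k → cycAux w (xs ++ replicate k 0) ≡ cycAux w xs
cycAux-++-zeros w []       zero    = refl
cycAux-++-zeros w []       (suc k) = cong₂ ℤ._+_ (ℤ.*-zeroʳ w) (cycAux-++-zeros (w ℤ.- (ℤ.+ 2)) [] k)
cycAux-++-zeros w (x ∷ xs) k       = cong (ℤ._+_ (w ℤ.* (ℤ.+ x))) (cycAux-++-zeros (w ℤ.- (ℤ.+ 2)) xs k)

decreasing-++-zeros : ∀ {xs} k → Linked _≥_ xs → Linked _≥_ (xs ++ replicate k 0)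
decreasing-++-zeros {[]}         zero          _         = []
decreasing-++-zeros {[]}         (suc zero)    _         = [-]
decreasing-++-zeros {[]}         (suc (suc k)) _         = z≤n ∷ decreasing-++-zeros (suc k) []
decreasing-++-zeros {x ∷ []}     zero          _         = [-]
decreasing-++-zeros {x ∷ []}     (suc k)       _         = z≤n ∷ decreasing-++-zeros (suc k) []
decreasing-++-zeros {x ∷ y ∷ xs} k             (y≤x ∷ ↓) = y≤x ∷ decreasing-++-zeros k ↓

sum-dropZeros : ∀ {q} → Linked _≥_ q → sum (dropZeros q) ≡ sum q
sum-dropZeros {q} ↓ = trans (sym (sum-++-zeros (dropZeros q) _)) (cong sum (padTo-dropZeros ↓))

cycAux-dropZeros : ∀ w {q} → Linked _≥_ q → cycAux w (dropZeros q) ≡ cycAux w q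
cycAux-dropZeros w {q} ↓ =
  trans (sym (cycAux-++-zeros w (dropZeros q) _)) (cong (cycAux w) (padTo-dropZeros ↓))

length≤sum : ∀ {xs} → All (_> 0) xs → length xs ≤ sum xs
length≤sum []                           = z≤n
length≤sum (_∷_ {x = suc x} {xs} _ xs>0) = s≤s (≤-trans (length≤sum xs>0) (m≤n+m (sum xs) x))

cycAux-odd : ∀ o xs → cycAux (ℤ.- (ℤ.+ suc (2 * o))) xs ≡ ℤ.- (ℤ.+ oddWeightedSum o xs)
cycAux-odd o []       = refl
cycAux-odd o (x ∷ xs) = begin
  ℤ.- a ℤ.* (ℤ.+ x) ℤ.+ cycAux (ℤ.- a ℤ.- (ℤ.+ 2)) xs
    ≡⟨ cong (λ w → ℤ.- a ℤ.* (ℤ.+ x) ℤ.+ cycAux w xs) next-odd ⟩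
  ℤ.- a ℤ.* (ℤ.+ x) ℤ.+ cycAux (ℤ.- (ℤ.+ suc (2 * suc o))) xs
    ≡⟨ cong (ℤ._+_ (ℤ.- a ℤ.* (ℤ.+ x))) (cycAux-odd (suc o) xs) ⟩
  ℤ.- a ℤ.* (ℤ.+ x) ℤ.+ ℤ.- (ℤ.+ b)
    ≡⟨ negate-linear a (ℤ.+ x) (ℤ.+ b) ⟩
  ℤ.- (a ℤ.* (ℤ.+ x) ℤ.+ (ℤ.+ b))
    ≡⟨ cong (λ i → ℤ.- (i ℤ.+ (ℤ.+ b))) (ℤ.pos-* (suc (2 * o)) x) ⟨
  ℤ.- (ℤ.+ oddWeightedSum o (x ∷ xs)) ∎
  where
  open ≡-Reasoning
  a : ℤ
  a = ℤ.+ suc (2 * o)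
  b : ℕ
  b = oddWeightedSum (suc o) xs
  odd-step : ∀ o → suc (2 * o) + 2 ≡ suc (2 * suc o)
  odd-step = solve-∀
  next-odd : ℤ.- a ℤ.- (ℤ.+ 2) ≡ ℤ.- (ℤ.+ suc (2 * suc o))
  next-odd = trans (sym (ℤ.neg-distrib-+ a (ℤ.+ 2))) (cong (ℤ.-_ ∘ ℤ.+_) (odd-step o))
  negate-linear : ∀ i j k → ℤ.- i ℤ.* j ℤ.+ ℤ.- k ≡ ℤ.- (i ℤ.* j ℤ.+ k)
  negate-linear = ℤ-Solver.solve-∀

cyc-∷ : ∀ x xs → cyc (x ∷ xs) ≡ (ℤ.+ x) ℤ.- (ℤ.+ oddWeightedSum 0 xs)
cyc-∷ x xs = cong₂ ℤ._+_ (ℤ.*-identityˡ (ℤ.+ x)) (cycAux-odd 0 xs)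

pos-+-minus : ∀ s b → (ℤ.+ (s + b)) ℤ.- (ℤ.+ b) ≡ ℤ.+ s
pos-+-minus s b = cancel (ℤ.+ s) (ℤ.+ b)
  where
  cancel : ∀ i j → i ℤ.+ j ℤ.- j ≡ i
  cancel = ℤ-Solver.solve-∀

pos-minus≡⇒ : ∀ {x b s} → (ℤ.+ x) ℤ.- (ℤ.+ b) ≡ ℤ.+ s → x ≡ s + b
pos-minus≡⇒ {x} {b} {s} x-b≡s = ℤ.+-injective (begin
  ℤ.+ x                           ≡⟨ uncancel (ℤ.+ x) (ℤ.+ b) ⟩
  (ℤ.+ x) ℤ.- (ℤ.+ b) ℤ.+ (ℤ.+ b) ≡⟨ cong (ℤ._+ (ℤ.+ b)) x-b≡s ⟩
  ℤ.+ (s + b)                     ∎)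
  where
  open ≡-Reasoning
  uncancel : ∀ i j → i ≡ i ℤ.- j ℤ.+ j
  uncancel = ℤ-Solver.solve-∀

oddWeightedSum-∷-decreasing : ∀ s {t} → Linked _≥_ t → Linked _≥_ (s + oddWeightedSum 0 t ∷ t)
oddWeightedSum-∷-decreasing s {[]}    _ = [-]
oddWeightedSum-∷-decreasing s {x ∷ t} ↓ = x≤ ∷ ↓
  where
  x≤ : x ≤ s + (1 * x + oddWeightedSum 1 t)
  x≤ = ≤-trans (≤-trans (≤-reflexive (sym (*-identityˡ x))) (m≤m+n (1 * x) _)) (m≤n+m _ s)

-- The code (s , c) of λ: s = c(λ), and the suffix sums of c are the parts n₂, n₃, … padded with zeros.
decodePadded : ℕ × List ℕ → List ℕ
decodePadded (s , c) = s + oddWeightedSum 0 (suffixSums c) ∷ suffixSums c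

decode : ℕ × List ℕ → List ℕ
decode = dropZeros ∘ decodePadded

decodePadded-decreasing : ∀ sc → Linked _≥_ (decodePadded sc)
decodePadded-decreasing (s , c) = oddWeightedSum-∷-decreasing s (suffixSums-decreasing c)

cyc-decode : ∀ sc → cyc (decode sc) ≡ ℤ.+ proj₁ sc
cyc-decode (s , c) = trans (cycAux-dropZeros (ℤ.+ 1) (decodePadded-decreasing (s , c)))
                           (trans (cyc-∷ (s + oddWeightedSum 0 (suffixSums c)) (suffixSums c))
                                  (pos-+-minus s (oddWeightedSum 0 (suffixSums c))))

Code : ℕ → ℕ × List ℕ → Set
Code n (s , c) = s + length c ≡ n × pronicWeightedSum 0 c ≡ length c

decode-attainable : ∀ {n} sc → Code n sc → IsPartition n (decode sc) × Attainable (decode sc)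
decode-attainable {n} (s , c) (s+|c|≡n , weight≡|c|) =
  (All.all-filter (_>? 0) q , Linked.filter⁺ (_>? 0) (λ x≥y y≥z → ≤-trans y≥z x≥y) q↓ , sum≡n) ,
  subst (ℤ.+ 0 ℤ.≤_) (sym (cyc-decode (s , c))) (ℤ.+≤+ z≤n)
  where
  open ≡-Reasoning
  q t : List ℕ
  q  = decodePadded (s , c)
  t  = suffixSums c
  q↓ : Linked _≥_ q
  q↓ = decodePadded-decreasing (s , c)
  sum≡n : sum (decode (s , c)) ≡ n
  sum≡n = begin
    sum (dropZeros q)                          ≡⟨ sum-dropZeros q↓ ⟩
    s + oddWeightedSum 0 t + sum t             ≡⟨ +-assoc s _ (sum t) ⟩
    s + (oddWeightedSum 0 t + sum t)           ≡⟨ cong (s +_) (pronicWeightedSum-suffixSums c) ⟩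
    s + pronicWeightedSum 0 c                  ≡⟨ cong (s +_) weight≡|c| ⟩
    s + length c                               ≡⟨ s+|c|≡n ⟩
    n                                          ∎

-- The tail is padded to length n ∸ s, enough room since n ∸ s = Σ_{i≥2} (2i−2) nᵢ.
encode : ℕ → List ℕ → ℕ × List ℕ
encode n p = ∣ cyc p ∣ , differences (drop 1 (padTo (suc (n ∸ ∣ cyc p ∣)) p))

encode-decode : ∀ {n} sc → Code n sc → encode n (decode sc) ≡ sc
encode-decode {n} (s , c) (s+|c|≡n , _) = begin
  ∣ cyc p ∣ , differences (drop 1 (padTo (suc (n ∸ ∣ cyc p ∣)) p))
    ≡⟨ cong (λ s′ → s′ , differences (drop 1 (padTo (suc (n ∸ s′)) p))) (cong ∣_∣ (cyc-decode (s , c))) ⟩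
  s , differences (drop 1 (padTo (suc (n ∸ s)) p))
    ≡⟨ cong (λ k → s , differences (drop 1 (padTo k p))) |q|≡1+n∸s ⟨
  s , differences (drop 1 (padTo (length q) (dropZeros q)))
    ≡⟨ cong (λ q′ → s , differences (drop 1 q′)) (padTo-dropZeros (decodePadded-decreasing (s , c))) ⟩
  s , differences (suffixSums c)
    ≡⟨ cong (s ,_) (differences-suffixSums c) ⟩
  s , c ∎
  where
  open ≡-Reasoning
  p q : List ℕ
  p = decode (s , c)
  q = decodePadded (s , c)
  |q|≡1+n∸s : length q ≡ suc (n ∸ s)
  |q|≡1+n∸s = cong suc (trans (length-suffixSums c)
                              (sym (trans (cong (_∸ s) (sym s+|c|≡n)) (m+n∸m≡n s (length c)))))

attainable-∷ : ∀ {n x xs} → IsPartition n (x ∷ xs) → Attainable (x ∷ xs) →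
               x ≡ ∣ cyc (x ∷ xs) ∣ + oddWeightedSum 0 xs ×
               n ≡ ∣ cyc (x ∷ xs) ∣ + (oddWeightedSum 0 xs + sum xs)
attainable-∷ {n} {x} {xs} (_ , _ , sum≡n) attainable = x≡s+b , n≡s+[b+Σxs]
  where
  s b : ℕ
  s = ∣ cyc (x ∷ xs) ∣
  b = oddWeightedSum 0 xs
  x≡s+b : x ≡ s + b
  x≡s+b = pos-minus≡⇒ (trans (sym (cyc-∷ x xs)) (sym (ℤ.0≤i⇒+∣i∣≡i attainable)))
  n≡s+[b+Σxs] : n ≡ s + (b + sum xs)
  n≡s+[b+Σxs] = trans (sym sum≡n) (trans (cong (_+ sum xs) x≡s+b) (+-assoc s b (sum xs)))

decode-encode : ∀ {n} p → IsPartition n p → Attainable p → Code n (encode n p) × decode (encode n p) ≡ p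
decode-encode []       (_ , _ , refl) _ = (refl , refl) , refl
decode-encode {n} (x ∷ xs) partition@(x∷xs>0 , x∷xs↓ , _) attainable =
  (s+|c|≡n , weight≡|c|) , decode≡
  where
  open ≡-Reasoning
  s b : ℕ
  s = ∣ cyc (x ∷ xs) ∣
  b = oddWeightedSum 0 xs
  t c : List ℕ
  t = padTo (n ∸ s) xs
  c = differences t
  x≡s+b : x ≡ s + b
  x≡s+b = proj₁ (attainable-∷ partition attainable)
  n≡s+L : n ≡ s + (b + sum xs)
  n≡s+L = proj₂ (attainable-∷ partition attainable)
  n∸s≡L : n ∸ s ≡ b + sum xs
  n∸s≡L = trans (cong (_∸ s) n≡s+L) (m+n∸m≡n s (b + sum xs))
  |xs|≤n∸s : length xs ≤ n ∸ s
  |xs|≤n∸s = subst (length xs ≤_) (sym n∸s≡L)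
                   (≤-trans (length≤sum (All.tail x∷xs>0)) (m≤n+m (sum xs) b))
  |c|≡L : length c ≡ b + sum xs
  |c|≡L = trans (length-differences t) (trans (length-padTo xs |xs|≤n∸s) n∸s≡L)
  suffixSums-c : suffixSums c ≡ t
  suffixSums-c = suffixSums-differences (decreasing-++-zeros _ (tail x∷xs↓))
  oddWeightedSum-t : oddWeightedSum 0 t ≡ b
  oddWeightedSum-t = oddWeightedSum-++-zeros 0 xs _
  s+|c|≡n : s + length c ≡ n
  s+|c|≡n = trans (cong (s +_) |c|≡L) (sym n≡s+L)
  weight≡|c| : pronicWeightedSum 0 c ≡ length c
  weight≡|c| = begin
    pronicWeightedSum 0 c
      ≡⟨ pronicWeightedSum-suffixSums c ⟨
    oddWeightedSum 0 (suffixSums c) + sum (suffixSums c)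
      ≡⟨ cong (λ t′ → oddWeightedSum 0 t′ + sum t′) suffixSums-c ⟩
    oddWeightedSum 0 t + sum t
      ≡⟨ cong₂ _+_ oddWeightedSum-t (sum-++-zeros xs _) ⟩
    b + sum xs
      ≡⟨ |c|≡L ⟨
    length c ∎
  decode≡ : decode (s , c) ≡ x ∷ xs
  decode≡ = begin
    dropZeros (s + oddWeightedSum 0 (suffixSums c) ∷ suffixSums c)
      ≡⟨ cong (λ t′ → dropZeros (s + oddWeightedSum 0 t′ ∷ t′)) suffixSums-c ⟩
    dropZeros (s + oddWeightedSum 0 t ∷ t)
      ≡⟨ cong (λ y → dropZeros (y ∷ t)) (trans (cong (s +_) oddWeightedSum-t) (sym x≡s+b)) ⟩
    dropZeros (x ∷ t)
      ≡⟨ dropZeros-++-zeros _ x∷xs>0 ⟩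
    x ∷ xs ∎

codes : ℕ → List (ℕ × List ℕ)
codes = convolve (exactQuotients 1) (λ l → weightedLists l l)

length-codes : ∀ n → length (codes n) ≡ rhs n
length-codes = length-convolve {F = exactQuotients 1} {G = λ l → weightedLists l l}
                 (length-exactQuotients 1) (λ l → length-weightedLists l l)

codes-listing : ∀ n → IsListing (Code n) (codes n)
codes-listing n = listing-cong convolution⇔code
  (convolve-listing (exactQuotients-listing 1) (λ l → weightedLists-listing l l)
                    (λ _ _ _ s≡k s≡k′ → trans (sym s≡k) s≡k′) n)
  where
  convolution⇔code : ∀ sc → Convolution (λ k s → 1 * s ≡ k) (λ l → Weighted l l) n sc ⇔ Code n sc
  convolution⇔code (s , c) = mk⇔
    (λ { (_ , _ , k+l≡n , refl , refl , weight≡l) →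
           trans (cong (_+ length c) (sym 1*s≡s)) k+l≡n , weight≡l })
    (λ (s+|c|≡n , weight≡|c|) →
       1 * s , length c , trans (cong (_+ length c) 1*s≡s) s+|c|≡n , refl , refl , weight≡|c|)
    where
    1*s≡s : 1 * s ≡ s
    1*s≡s = *-identityˡ s

theorem1p1 : (n : ℕ) → ∃ λ (L : List (List ℕ)) →
    ((p : List ℕ) → (p ∈ L) ⇔ (IsPartition n p × Attainable p))
    × Unique L × length L ≡ rhs n
theorem1p1 n = map decode (codes n) , membership attainables , unique attainables ,
               trans (length-map decode (codes n)) (length-codes n)
  where
  attainables : IsListing (λ p → IsPartition n p × Attainable p) (map decode (codes n))
  attainables = map-listing decode (codes-listing n) decode-attainable
    (λ p (p-partition , p-attainable) → encode n p , decode-encode p p-partition p-attainable)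
    (λ sc sc′ code code′ decode≡ →
       trans (sym (encode-decode sc code)) (trans (cong (encode n) decode≡) (encode-decode sc′ code′)))
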